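{- Let $\mathcal{C}$ be a Seely category with exponential comonad $(!,\mathrm{der},\mathrm{dig})$, and let $(S,\pi_0,\pi_1,\sigma)$ be a summability structure on $\mathcal{C}$. Let $D_X:!SX\to S!X$ be a natural transformation satisfying $\pi_0\circ D_X=\,!\pi_0$ for all $X$, and set $\partial_X:=\pi_1\circ D_X:!SX\to\,!X$. Then the equation $$S(\mathrm{der}_X)\circ D_X=\mathrm{der}_{SX}\qquad(\text{for all }X)$$ holds if and only if the equation $$\mathrm{der}_X\circ\partial_X=\mathrm{der}_X\circ\,!\pi_1\qquad(\text{for all }X)$$ holds.
   Context: A Seely category is a symmetric monoidal closed category $(\mathcal{C},\otimes,1)$ with finite products $(\&,\top)$, a comonad $(!,\mathrm{der},\mathrm{dig})$ (with $\mathrm{der}_X:!X\to X$ and $\mathrm{dig}_X:!X\to\,!!X$ natural, satisfying the comonad laws), and isomorphisms $m^0:1\to\,!\top$ and natural $m^2_{X,Y}:!X\otimes!Y\to\,!(X\&Y)$ making $!$ a strong symmetric monoidal functor from $(\mathcal{C},\&,\top)$ to $(\mathcal{C},\otimes,1)$. $\mathcal{C}$ has distinguished morphisms $0_{X,Y}$. A summability structure $(S,\pi_0,\pi_1,\sigma)$ consists of a functor $S:\mathcal{C}\to\mathcal{C}$ with $S(0)=0$, natural transformations $\pi_0,\pi_1,\sigma:S\Rightarrow\mathrm{Id}$ with $\pi_0,\pi_1$ jointly monic (if $\pi_0\circ f=\pi_0\circ g$ and $\pi_1\circ f=\pi_1\circ g$ then $f=g$), such that the induced partial sum ($f_0+f_1:=\sigma\circ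 h$ where $h$ is the unique morphism with $\pi_i\circ h=f_i$, when it exists) is a partial commutative monoid (commutative, with $0$ neutral, and associative in the partial sense). -}

module Defs where

open import Level using (Level; _⊔_) renaming (suc to lsuc)
open import Relation.Binary.PropositionalEquality using (_≡_)
open import Data.Product using (Σ; _×_; _,_; ∃)

record Category (o ℓ : Level) : Set (lsuc (o ⊔ ℓ)) where
  infixr 9 _∘_
  field
    Obj  : Set o
    Hom  : Obj → Obj → Set ℓ
    id   : ∀ {X} → Hom X X
    _∘_  : ∀ {X Y Z} → Hom Y Z → Hom X Y → Hom X Z
    identityˡ : ∀ {X Y} {f : Hom X Y} → id ∘ f ≡ f
    identityʳ : ∀ {X Y} {f : Hom X Y} → f ∘ id ≡ f
    assoc     : ∀ {W X Y Z} {f : Hom W X} {g : Hom X Y} {h : Hom Y Z} →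
                (h ∘ g) ∘ f ≡ h ∘ (g ∘ f)

module _ {o ℓ : Level} (C : Category o ℓ) where
  open Category C

  IsIso : ∀ {X Y} → Hom X Y → Hom Y X → Set ℓ
  IsIso f g = (g ∘ f ≡ id) × (f ∘ g ≡ id)

  record Endofunctor : Set (o ⊔ ℓ) where
    field
      F₀ : Obj → Obj
      F₁ : ∀ {X Y} → Hom X Y → Hom (F₀ X) (F₀ Y)
      F-id : ∀ {X} → F₁ (id {X}) ≡ id
      F-∘  : ∀ {X Y Z} (f : Hom X Y) (g : Hom Y Z) → F₁ (g ∘ f) ≡ F₁ g ∘ F₁ f

  IsNatural : (F G : Endofunctor) →
              (∀ X → Hom (Endofunctor.F₀ F X) (Endofunctor.F₀ G X)) → Set (o ⊔ ℓ)
  IsNatural F G η = ∀ {X Y} (f : Hom X Y) →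
    Endofunctor.F₁ G f ∘ η X ≡ η Y ∘ Endofunctor.F₁ F f

  idF : Endofunctor
  idF = record { F₀ = λ X → X ; F₁ = λ f → f ; F-id = _≡_.refl ; F-∘ = λ _ _ → _≡_.refl }

  record SymmetricMonoidalClosed : Set (o ⊔ ℓ) where
    infixr 10 _⊗_ _⊗₁_
    field
      _⊗_  : Obj → Obj → Obj
      _⊗₁_ : ∀ {X X′ Y Y′} → Hom X X′ → Hom Y Y′ → Hom (X ⊗ Y) (X′ ⊗ Y′)
      ⊗-id : ∀ {X Y} → (id {X} ⊗₁ id {Y}) ≡ id
      ⊗-∘  : ∀ {X X′ X″ Y Y′ Y″} (f : Hom X X′) (f′ : Hom X′ X″) (g : Hom Y Y′) (g′ : Hom Y′ Y″) →
             ((f′ ∘ f) ⊗₁ (g′ ∘ g)) ≡ (f′ ⊗₁ g′) ∘ (f ⊗₁ g)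
      𝟙 : Obj
      α  : ∀ X Y Z → Hom ((X ⊗ Y) ⊗ Z) (X ⊗ (Y ⊗ Z))
      α⁻ : ∀ X Y Z → Hom (X ⊗ (Y ⊗ Z)) ((X ⊗ Y) ⊗ Z)
      α-iso : ∀ X Y Z → IsIso (α X Y Z) (α⁻ X Y Z)
      α-nat : ∀ {X X′ Y Y′ Z Z′} (f : Hom X X′) (g : Hom Y Y′) (h : Hom Z Z′) →
              (f ⊗₁ (g ⊗₁ h)) ∘ α X Y Z ≡ α X′ Y′ Z′ ∘ ((f ⊗₁ g) ⊗₁ h)
      λ⊗  : ∀ X → Hom (𝟙 ⊗ X) X
      λ⊗⁻ : ∀ X → Hom X (𝟙 ⊗ X)
      λ⊗-iso : ∀ X → IsIso (λ⊗ X) (λ⊗⁻ X)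
      λ⊗-nat : ∀ {X Y} (f : Hom X Y) → f ∘ λ⊗ X ≡ λ⊗ Y ∘ (id ⊗₁ f)
      ρ⊗  : ∀ X → Hom (X ⊗ 𝟙) X
      ρ⊗⁻ : ∀ X → Hom X (X ⊗ 𝟙)
      ρ⊗-iso : ∀ X → IsIso (ρ⊗ X) (ρ⊗⁻ X)
      ρ⊗-nat : ∀ {X Y} (f : Hom X Y) → f ∘ ρ⊗ X ≡ ρ⊗ Y ∘ (f ⊗₁ id)
      γ  : ∀ X Y → Hom (X ⊗ Y) (Y ⊗ X)
      γ-nat : ∀ {X X′ Y Y′} (f : Hom X X′) (g : Hom Y Y′) →
              (g ⊗₁ f) ∘ γ X Y ≡ γ X′ Y′ ∘ (f ⊗₁ g)
      γ-invol : ∀ X Y → γ Y X ∘ γ X Y ≡ id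
      pentagon : ∀ W X Y Z →
        (id ⊗₁ α X Y Z) ∘ (α W (X ⊗ Y) Z ∘ (α W X Y ⊗₁ id))
          ≡ α W X (Y ⊗ Z) ∘ α (W ⊗ X) Y Z
      triangle : ∀ X Y → (id ⊗₁ λ⊗ Y) ∘ α X 𝟙 Y ≡ ρ⊗ X ⊗₁ id
      hexagon : ∀ X Y Z →
        α Y Z X ∘ (γ X (Y ⊗ Z) ∘ α X Y Z)
          ≡ (id ⊗₁ γ X Z) ∘ (α Y X Z ∘ (γ X Y ⊗₁ id))
      _⊸_ : Obj → Obj → Obj
      ev  : ∀ X Y → Hom ((X ⊸ Y) ⊗ X) Y
      cur : ∀ {Z X Y} → Hom (Z ⊗ X) Y → Hom Z (X ⊸ Y)
      cur-β : ∀ {Z X Y} (f : Hom (Z ⊗ X) Y) → ev X Y ∘ (cur f ⊗₁ id) ≡ f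
      cur-η : ∀ {Z X Y} (g : Hom Z (X ⊸ Y)) → cur (ev X Y ∘ (g ⊗₁ id)) ≡ g

  record FiniteProducts : Set (o ⊔ ℓ) where
    infixr 11 _&_
    field
      _&_ : Obj → Obj → Obj
      p₁  : ∀ {X Y} → Hom (X & Y) X
      p₂  : ∀ {X Y} → Hom (X & Y) Y
      ⟨_,_⟩ : ∀ {Z X Y} → Hom Z X → Hom Z Y → Hom Z (X & Y)
      p₁-β : ∀ {Z X Y} (f : Hom Z X) (g : Hom Z Y) → p₁ ∘ ⟨ f , g ⟩ ≡ f
      p₂-β : ∀ {Z X Y} (f : Hom Z X) (g : Hom Z Y) → p₂ ∘ ⟨ f , g ⟩ ≡ g
      pair-unique : ∀ {Z X Y} (h : Hom Z (X & Y)) → ⟨ p₁ ∘ h , p₂ ∘ h ⟩ ≡ h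
      ⊤ : Obj
      term : ∀ X → Hom X ⊤
      term-unique : ∀ {X} (h : Hom X ⊤) → h ≡ term X

    α& : ∀ X Y Z → Hom ((X & Y) & Z) (X & (Y & Z))
    α& X Y Z = ⟨ p₁ ∘ p₁ , ⟨ p₂ ∘ p₁ , p₂ ⟩ ⟩
    λ& : ∀ X → Hom (⊤ & X) X
    λ& X = p₂
    ρ& : ∀ X → Hom (X & ⊤) X
    ρ& X = p₁
    γ& : ∀ X Y → Hom (X & Y) (Y & X)
    γ& X Y = ⟨ p₂ , p₁ ⟩
    _&₁_ : ∀ {X X′ Y Y′} → Hom X X′ → Hom Y Y′ → Hom (X & Y) (X′ & Y′)
    f &₁ g = ⟨ f ∘ p₁ , g ∘ p₂ ⟩

record SeelyCategory (o ℓ : Level) : Set (lsuc (o ⊔ ℓ)) where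
  field
    cat : Category o ℓ
  open Category cat public
  field
    smc  : SymmetricMonoidalClosed cat
    prod : FiniteProducts cat
  open SymmetricMonoidalClosed smc public
  open FiniteProducts prod public
  field
    0m : ∀ X Y → Hom X Y
    !F  : Endofunctor cat
  open Endofunctor !F public using () renaming (F₀ to !_; F₁ to !₁)
  field
    der : ∀ X → Hom (! X) X
    dig : ∀ X → Hom (! X) (! (! X))
    der-nat : IsNatural cat !F (idF cat) der
    dig-nat : ∀ {X Y} (f : Hom X Y) → !₁ (!₁ f) ∘ dig X ≡ dig Y ∘ !₁ f
    comonad-idˡ : ∀ X → der (! X) ∘ dig X ≡ id
    comonad-idʳ : ∀ X → !₁ (der X) ∘ dig X ≡ id
    comonad-assoc : ∀ X → dig (! X) ∘ dig X ≡ !₁ (dig X) ∘ dig X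
    -- Seely isomorphisms: ! strong symmetric monoidal (C,&,⊤) → (C,⊗,1)
    m⁰  : Hom 𝟙 (! ⊤)
    m⁰⁻ : Hom (! ⊤) 𝟙
    m⁰-iso : IsIso cat m⁰ m⁰⁻
    m²  : ∀ X Y → Hom (! X ⊗ ! Y) (! (X & Y))
    m²⁻ : ∀ X Y → Hom (! (X & Y)) (! X ⊗ ! Y)
    m²-iso : ∀ X Y → IsIso cat (m² X Y) (m²⁻ X Y)
    m²-nat : ∀ {X X′ Y Y′} (f : Hom X X′) (g : Hom Y Y′) →
             !₁ (f &₁ g) ∘ m² X Y ≡ m² X′ Y′ ∘ (!₁ f ⊗₁ !₁ g)
    m-assoc : ∀ X Y Z →
      !₁ (α& X Y Z) ∘ (m² (X & Y) Z ∘ (m² X Y ⊗₁ id))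
        ≡ m² X (Y & Z) ∘ ((id ⊗₁ m² Y Z) ∘ α (! X) (! Y) (! Z))
    m-unitˡ : ∀ X → !₁ (λ& X) ∘ (m² ⊤ X ∘ (m⁰ ⊗₁ id)) ≡ λ⊗ (! X)
    m-unitʳ : ∀ X → !₁ (ρ& X) ∘ (m² X ⊤ ∘ (id ⊗₁ m⁰)) ≡ ρ⊗ (! X)
    m-sym : ∀ X Y → !₁ (γ& X Y) ∘ m² X Y ≡ m² Y X ∘ γ (! X) (! Y)

module _ {o ℓ : Level} (𝒞 : SeelyCategory o ℓ) where
  open SeelyCategory 𝒞

  record SummabilityStructure : Set (o ⊔ ℓ) where
    field
      SF : Endofunctor cat
    open Endofunctor SF public using () renaming (F₀ to S; F₁ to S₁)
    field
      S-zero : ∀ X Y → S₁ (0m X Y) ≡ 0m (S X) (S Y)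
      π₀ : ∀ X → Hom (S X) X
      π₁ : ∀ X → Hom (S X) X
      σ  : ∀ X → Hom (S X) X
      π₀-nat : IsNatural cat SF (idF cat) π₀
      π₁-nat : IsNatural cat SF (idF cat) π₁
      σ-nat  : IsNatural cat SF (idF cat) σ
      jointly-monic : ∀ {Z X} (f g : Hom Z (S X)) →
        π₀ X ∘ f ≡ π₀ X ∘ g → π₁ X ∘ f ≡ π₁ X ∘ g → f ≡ g

    Witness : ∀ {Z X} → Hom Z X → Hom Z X → Hom Z (S X) → Set ℓ
    Witness {X = X} f₀ f₁ h = (π₀ X ∘ h ≡ f₀) × (π₁ X ∘ h ≡ f₁)

    SumIs : ∀ {Z X} → Hom Z X → Hom Z X → Hom Z X → Set ℓ
    SumIs {X = X} f₀ f₁ g = Σ (Hom _ (S X)) λ h → Witness f₀ f₁ h × (σ X ∘ h ≡ g)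

    field
      sum-comm : ∀ {Z X} (f₀ f₁ g : Hom Z X) → SumIs f₀ f₁ g → SumIs f₁ f₀ g
      sum-zeroʳ : ∀ {Z X} (f : Hom Z X) → SumIs f (0m Z X) f
      sum-zeroˡ : ∀ {Z X} (f : Hom Z X) → SumIs (0m Z X) f f
      sum-assocˡ : ∀ {Z X} (f₀ f₁ f₂ g₀₁ g : Hom Z X) →
        SumIs f₀ f₁ g₀₁ → SumIs g₀₁ f₂ g →
        ∃ λ g₁₂ → SumIs f₁ f₂ g₁₂ × SumIs f₀ g₁₂ g
      sum-assocʳ : ∀ {Z X} (f₀ f₁ f₂ g₁₂ g : Hom Z X) →
        SumIs f₁ f₂ g₁₂ → SumIs f₀ g₁₂ g →
        ∃ λ g₀₁ → SumIs f₀ f₁ g₀₁ × SumIs g₀₁ f₂ g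

{-# OPTIONS --safe #-}
-- Both sides of S(der) ∘ D = der_S are maps into S !X, so by joint monicity of
-- π₀, π₁ they agree iff their π₀- and π₁-components do.  Naturality of πᵢ and of
-- der turns the πᵢ-component of this equation into der ∘ πᵢ ∘ D = der ∘ !πᵢ.
-- For i = 0 this always holds since π₀ ∘ D = !π₀; for i = 1 it is the equation
-- der ∘ ∂ = der ∘ !π₁.
module Submission where

open import Defs
open import Level using (Level)
open import Relation.Binary.PropositionalEquality using (_≡_; sym; trans; cong; module ≡-Reasoning)
open import Data.Product using (_×_; _,_)
open import Function.Bundles using (_⇔_; mk⇔; module Equivalence)

open Equivalence using (to; from)

module _ {o ℓ : Level} (C : Category o ℓ) where
  open Category C
  open Endofunctor using (F₀; F₁)
  open ≡-Reasoning

  natural⇒id-slide : (F : Endofunctor C) (η : ∀ X → Hom (F₀ F X) X) → IsNatural C F (idF C) η →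
                     ∀ {W A B} (f : Hom A B) (g : Hom W (F₀ F A)) →
                     f ∘ (η A ∘ g) ≡ η B ∘ (F₁ F f ∘ g)
  natural⇒id-slide F η η-nat {A = A} {B} f g = begin
    f ∘ (η A ∘ g)        ≡⟨ sym assoc ⟩
    (f ∘ η A) ∘ g        ≡⟨ cong (_∘ g) (η-nat f) ⟩
    (η B ∘ F₁ F f) ∘ g   ≡⟨ assoc ⟩
    η B ∘ (F₁ F f ∘ g)   ∎

module _ {o ℓ : Level} (𝒞 : SeelyCategory o ℓ) (𝒮 : SummabilityStructure 𝒞) where
  open SeelyCategory 𝒞
  open SummabilityStructure 𝒮

  S₁der-component⇔der-component :
    (η : ∀ X → Hom (S X) X) → IsNatural cat SF (idF cat) η →
    ∀ {X} (g : Hom (! (S X)) (S (! X))) →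
    (η X ∘ (S₁ (der X) ∘ g) ≡ η X ∘ der (S X)) ⇔ (der X ∘ (η (! X) ∘ g) ≡ der X ∘ !₁ (η X))
  S₁der-component⇔der-component η η-nat {X} g =
    mk⇔ (λ e → trans slide (trans e (der-nat (η X))))
        (λ e → trans (sym slide) (trans e (sym (der-nat (η X)))))
    where
    slide : der X ∘ (η (! X) ∘ g) ≡ η X ∘ (S₁ (der X) ∘ g)
    slide = natural⇒id-slide cat SF η η-nat (der X) g

  π₀-S₁der∘D : (D : ∀ X → Hom (! (S X)) (S (! X))) → (∀ X → π₀ (! X) ∘ D X ≡ !₁ (π₀ X)) →
               ∀ X → π₀ X ∘ (S₁ (der X) ∘ D X) ≡ π₀ X ∘ der (S X)
  π₀-S₁der∘D D D-π₀ X =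
    from (S₁der-component⇔der-component π₀ π₀-nat (D X)) (cong (der X ∘_) (D-π₀ X))

mainTheorem3 : ∀ {o ℓ : Level} (𝒞 : SeelyCategory o ℓ) (𝒮 : SummabilityStructure 𝒞) →
    let open SeelyCategory 𝒞 in
    let open SummabilityStructure 𝒮 in
    (D : ∀ X → Hom (! (S X)) (S (! X))) →
    (D-nat : ∀ {X Y} (f : Hom X Y) → S₁ (!₁ f) ∘ D X ≡ D Y ∘ !₁ (S₁ f)) →
    (D-π₀ : ∀ X → π₀ (! X) ∘ D X ≡ !₁ (π₀ X)) →
    let ∂ : ∀ X → Hom (! (S X)) (! X)
        ∂ X = π₁ (! X) ∘ D X
    in ((∀ X → S₁ (der X) ∘ D X ≡ der (S X)) → (∀ X → der X ∘ ∂ X ≡ der X ∘ !₁ (π₁ X)))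
     × ((∀ X → der X ∘ ∂ X ≡ der X ∘ !₁ (π₁ X)) → (∀ X → S₁ (der X) ∘ D X ≡ der (S X)))
mainTheorem3 𝒞 𝒮 D _ D-π₀ = der-∂ , S₁der∘D
  where
  open SeelyCategory 𝒞
  open SummabilityStructure 𝒮

  π₁-component : ∀ X → (π₁ X ∘ (S₁ (der X) ∘ D X) ≡ π₁ X ∘ der (S X))
                      ⇔ (der X ∘ (π₁ (! X) ∘ D X) ≡ der X ∘ !₁ (π₁ X))
  π₁-component X = S₁der-component⇔der-component 𝒞 𝒮 π₁ π₁-nat (D X)

  der-∂ : (∀ X → S₁ (der X) ∘ D X ≡ der (S X)) → ∀ X → der X ∘ (π₁ (! X) ∘ D X) ≡ der X ∘ !₁ (π₁ X)
  der-∂ e X = to (π₁-component X) (cong (π₁ X ∘_) (e X))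

  S₁der∘D : (∀ X → der X ∘ (π₁ (! X) ∘ D X) ≡ der X ∘ !₁ (π₁ X)) → ∀ X → S₁ (der X) ∘ D X ≡ der (S X)
  S₁der∘D e X = jointly-monic _ _ (π₀-S₁der∘D 𝒞 𝒮 D D-π₀ X) (from (π₁-component X) (e X))
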